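{- For every $n\geq 1$, \[|\mathrm{VPF}_{n}^{\uparrow}| = \frac{(1 + \sqrt{2})^n + (1 - \sqrt{2})^n }{2}.\]
   Context: For $n\in\mathbb{N}$ let $[n]=\{1,\dots,n\}$. A preference list $\alpha=(a_1,\dots,a_n)\in[n]^n$ describes $n$ cars entering, in order $i=1,\dots,n$, a one-way street with spots $1,\dots,n$; car $i$ prefers spot $a_i$. Under the vacillating parking rule, car $i$ parks in spot $a_i$ if unoccupied; otherwise in spot $a_i-1$ if it exists and is unoccupied; otherwise in spot $a_i+1$ if it exists and is unoccupied; otherwise it fails to park. If all cars park, $\alpha$ is a vacillating parking function of length $n$. $\mathrm{VPF}_n^{\uparrow}$ denotes the set of vacillating parking functions $(a_1,\dots,a_n)$ of length $n$ with $a_1\leq\cdots\leq a_n$. -}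

module Defs where

open import Data.Nat using (ℕ; zero; suc; _≤ᵇ_; _≡ᵇ_; _∸_; _+_)
open import Data.Bool using (Bool; true; false; _∧_; not; if_then_else_)
open import Data.Bool.ListAction using (any)
open import Data.List using (List; []; _∷_; map; concatMap; length; filterᵇ; upTo)
open import Data.Maybe using (Maybe; just; nothing)
open import Data.Integer using (ℤ) renaming (_+_ to _+ℤ_; _*_ to _*ℤ_)
import Data.Integer as ℤ

-- Vacillating parking rule.
-- Spots are 1,…,n (as natural numbers); the state is the list of
-- occupied spots.

occupied : List ℕ → ℕ → Bool
occupied occ s = any (λ t → t ≡ᵇ s) occ

validSpot : ℕ → ℕ → Bool
validSpot n s = (1 ≤ᵇ s) ∧ (s ≤ᵇ n)

free : ℕ → List ℕ → ℕ → Bool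
free n occ s = validSpot n s ∧ not (occupied occ s)

parkCar : ℕ → List ℕ → ℕ → Maybe (List ℕ)
parkCar n occ a =
  if free n occ a then just (a ∷ occ)
  else if free n occ (a ∸ 1) then just ((a ∸ 1) ∷ occ)
  else if free n occ (suc a) then just (suc a ∷ occ)
  else nothing

parkAll : ℕ → List ℕ → List ℕ → Bool
parkAll n occ [] = true
parkAll n occ (a ∷ as) with parkCar n occ a
... | just occ' = parkAll n occ' as
... | nothing   = false

-- α is a vacillating parking function of length n
-- (α is assumed to be in [n]^n; see isVPF↑ below).
isVPF : ℕ → List ℕ → Bool
isVPF n α = parkAll n [] α

nondecreasing : List ℕ → Bool
nondecreasing [] = true
nondecreasing (a ∷ []) = true
nondecreasing (a ∷ b ∷ as) = (a ≤ᵇ b) ∧ nondecreasing (b ∷ as)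

lists : ℕ → ℕ → List (List ℕ)
lists zero    k = [] ∷ []
lists (suc m) k = concatMap (λ a → map (a ∷_) (lists m k)) (map suc (upTo k))

VPF↑ : ℕ → List (List ℕ)
VPF↑ n = filterᵇ (λ α → isVPF n α ∧ nondecreasing α) (lists n n)

-- The ring ℤ[√2] = { a + b√2 : a b ∈ ℤ }, a subring of ℝ.
-- Since √2 is irrational, a + b√2 is represented uniquely by mk√ a b,
-- so equality of reals in ℤ[√2] is equality of the pairs.

record ℤ√2 : Set where
  constructor mk√
  field
    re : ℤ
    im : ℤ

open ℤ√2 public

infixl 6 _⊕_
infixl 7 _⊗_

_⊕_ : ℤ√2 → ℤ√2 → ℤ√2
mk√ a b ⊕ mk√ c d = mk√ (a +ℤ c) (b +ℤ d)

_⊗_ : ℤ√2 → ℤ√2 → ℤ√2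
mk√ a b ⊗ mk√ c d =
  mk√ ((a *ℤ c) +ℤ (ℤ.+ 2 *ℤ (b *ℤ d))) ((a *ℤ d) +ℤ (b *ℤ c))

one√ : ℤ√2
one√ = mk√ (ℤ.+ 1) (ℤ.+ 0)

_^√_ : ℤ√2 → ℕ → ℤ√2
x ^√ zero  = one√
x ^√ suc m = x ⊗ (x ^√ m)

fromℕ√ : ℕ → ℤ√2
fromℕ√ m = mk√ (ℤ.+ m) (ℤ.+ 0)

onePlusSqrt2 : ℤ√2
onePlusSqrt2 = mk√ (ℤ.+ 1) (ℤ.+ 1)

oneMinusSqrt2 : ℤ√2
oneMinusSqrt2 = mk√ (ℤ.+ 1) (ℤ.- (ℤ.+ 1))

module Submission where

open import Defs
open import Data.Nat using (ℕ; zero; suc; _+_; _*_; _∸_; _≤_; _<_; _≥_; z≤n; s≤s; _≤ᵇ_; _≡ᵇ_; _≟_; _≤?_)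
open import Data.Nat.Properties
import Data.Nat.Tactic.RingSolver as ℕ-Solver
open import Data.Bool using (Bool; true; false; _∧_; not; if_then_else_; T)
open import Data.Bool.Properties using (∧-zeroʳ)
open import Data.List using (List; []; _∷_; map; concatMap; filterᵇ; applyUpTo; _++_; length)
open import Data.List.Properties using (length-++; filter-++)
open import Data.Maybe using (Maybe; just; nothing; maybe′)
import Data.Maybe as Maybe
open import Data.Product using (_×_; _,_)
open import Data.Integer using (-_) renaming (_+_ to _+ℤ_; _*_ to _*ℤ_)
import Data.Integer as ℤ
import Data.Integer.Properties as ℤ
open import Function using (_∘_; id)
open import Relation.Binary.PropositionalEquality
open import Relation.Binary.Definitions using (tri<; tri≈; tri>)
open import Relation.Nullary using (yes; no; contradiction)

-- When preferences are weakly increasing, every car parks at or after the spot just before the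
-- previous car's preference. So if spots 1, …, m are filled, the next car must prefer m, m + 1 or
-- m + 2: the first two leave 1, …, m + 1 filled, while m + 2 leaves a hole at m + 1 that only the
-- very next car (preferring m + 2) can fill; any larger preference leaves more cars than reachable
-- vacant spots. Hence, with r cars to come, the number of completions satisfies
-- F (r + 2) = 2 F (r + 1) + F r, the Pell recurrence, and splitting on the first car's preference
-- (1 or 2) gives |VPF↑ n| = P n + P (n − 1) = H n, where (1 ± √2)^n = H n ± P n √2.

≤⇒≤ᵇ≡true : ∀ {m n} → m ≤ n → (m ≤ᵇ n) ≡ true
≤⇒≤ᵇ≡true {m} {n} m≤n with m ≤ᵇ n | ≤⇒≤ᵇ m≤n
... | true | _ = refl

>⇒≤ᵇ≡false : ∀ {m n} → n < m → (m ≤ᵇ n) ≡ false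
>⇒≤ᵇ≡false {m} {n} n<m with m ≤ᵇ n | ≤ᵇ⇒≤ m n
... | false | _     = refl
... | true  | m≤n = contradiction (m≤n _) (<⇒≱ n<m)

≤ᵇ≡true⇒≤ : ∀ {m n} → (m ≤ᵇ n) ≡ true → m ≤ n
≤ᵇ≡true⇒≤ {m} {n} eq = ≤ᵇ⇒≤ m n (subst T (sym eq) _)

≡ᵇ-refl : ∀ m → (m ≡ᵇ m) ≡ true
≡ᵇ-refl zero    = refl
≡ᵇ-refl (suc m) = ≡ᵇ-refl m

≢⇒≡ᵇ≡false : ∀ {m n} → m ≢ n → (m ≡ᵇ n) ≡ false
≢⇒≡ᵇ≡false {m} {n} m≢n with m ≡ᵇ n | ≡ᵇ⇒≡ m n
... | false | _    = refl
... | true  | m≡n = contradiction (m≡n _) m≢n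

suc-≤ᵇ : ∀ k t → (suc k ≤ᵇ t) ≡ not (k ≡ᵇ t) ∧ (k ≤ᵇ t)
suc-≤ᵇ k t with <-cmp t k
... | tri< t<k _ _ rewrite >⇒≤ᵇ≡false (m≤n⇒m≤1+n t<k) | >⇒≤ᵇ≡false t<k = sym (∧-zeroʳ _)
... | tri≈ _ refl _ rewrite >⇒≤ᵇ≡false (n<1+n t) | ≡ᵇ-refl t = refl
... | tri> _ k≢t k<t rewrite ≤⇒≤ᵇ≡true k<t | ≤⇒≤ᵇ≡true (<⇒≤ k<t) | ≢⇒≡ᵇ≡false (k≢t ∘ sym) = refl

∧-leftComm : ∀ x y z → x ∧ (y ∧ z) ≡ y ∧ (x ∧ z)
∧-leftComm true  y z = refl
∧-leftComm false y z = sym (∧-zeroʳ y)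

∑< : ℕ → (ℕ → ℕ) → ℕ
∑< zero    f = 0
∑< (suc m) f = f 0 + ∑< m (f ∘ suc)

syntax ∑< m (λ i → e) = ∑[ i < m ] e

∑<-cong : ∀ {f g} → f ≗ g → ∀ m → ∑< m f ≡ ∑< m g
∑<-cong f≗g zero    = refl
∑<-cong f≗g (suc m) = cong₂ _+_ (f≗g 0) (∑<-cong (f≗g ∘ suc) m)

∑<-zero : ∀ {f} m → (∀ i → i < m → f i ≡ 0) → ∑< m f ≡ 0
∑<-zero zero    _   = refl
∑<-zero (suc m) f≡0 rewrite f≡0 0 (s≤s z≤n) = ∑<-zero m (λ i i<m → f≡0 (suc i) (s≤s i<m))

∑<-+ : ∀ f x y → ∑< (x + y) f ≡ ∑< x f + ∑[ i < y ] f (x + i)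
∑<-+ f zero    y = refl
∑<-+ f (suc x) y = trans (cong (f 0 +_) (∑<-+ (f ∘ suc) x y)) (sym (+-assoc (f 0) _ _))

∑<-window : ∀ lo w e {m} f → lo + (w + e) ≡ m →
  (∀ i → i < lo → f i ≡ 0) → (∀ i → i < e → f (lo + (w + i)) ≡ 0) →
  ∑< m f ≡ ∑[ i < w ] f (i + lo)
∑<-window lo w e f refl head tail = begin
  ∑< (lo + (w + e)) f
    ≡⟨ ∑<-+ f lo (w + e) ⟩
  ∑< lo f + ∑< (w + e) (f ∘ (lo +_))
    ≡⟨ cong (_+ ∑< (w + e) (f ∘ (lo +_))) (∑<-zero lo head) ⟩
  ∑< (w + e) (f ∘ (lo +_))
    ≡⟨ ∑<-+ (f ∘ (lo +_)) w e ⟩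
  ∑< w (f ∘ (lo +_)) + ∑[ i < e ] f (lo + (w + i))
    ≡⟨ cong₂ _+_ (∑<-cong (λ i → cong f (+-comm lo i)) w) (∑<-zero e tail) ⟩
  ∑[ i < w ] f (i + lo) + 0
    ≡⟨ +-identityʳ _ ⟩
  ∑[ i < w ] f (i + lo)
    ∎
  where open ≡-Reasoning
module _ {A : Set} where

  length-filterᵇ-++ : ∀ (p : A → Bool) xs ys →
    length (filterᵇ p (xs ++ ys)) ≡ length (filterᵇ p xs) + length (filterᵇ p ys)
  length-filterᵇ-++ p xs ys = trans (cong length (filter-++ _ xs ys)) (length-++ (filterᵇ p xs))

  length-filterᵇ-cong : ∀ {p q : A → Bool} → p ≗ q → ∀ xs → length (filterᵇ p xs) ≡ length (filterᵇ q xs)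
  length-filterᵇ-cong p≗q []       = refl
  length-filterᵇ-cong {p} {q} p≗q (x ∷ xs) with p x | q x | p≗q x
  ... | true  | true  | refl = cong suc (length-filterᵇ-cong p≗q xs)
  ... | false | false | refl = length-filterᵇ-cong p≗q xs

  length-filterᵇ-none : ∀ {p : A → Bool} → (∀ x → p x ≡ false) → ∀ xs → length (filterᵇ p xs) ≡ 0
  length-filterᵇ-none p≡false []       = refl
  length-filterᵇ-none {p} p≡false (x ∷ xs) rewrite p≡false x = length-filterᵇ-none p≡false xs

  length-filterᵇ-map : ∀ {B : Set} (p : B → Bool) (f : A → B) xs →
    length (filterᵇ p (map f xs)) ≡ length (filterᵇ (p ∘ f) xs)
  length-filterᵇ-map p f []       = refl
  length-filterᵇ-map p f (x ∷ xs) with p (f x)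
  ... | true  = cong suc (length-filterᵇ-map p f xs)
  ... | false = length-filterᵇ-map p f xs

  length-filterᵇ-concatMap : ∀ (p : A → Bool) (F : ℕ → List A) g m →
    length (filterᵇ p (concatMap F (map suc (applyUpTo g m))))
      ≡ ∑[ i < m ] length (filterᵇ p (F (suc (g i))))
  length-filterᵇ-concatMap p F g zero    = refl
  length-filterᵇ-concatMap p F g (suc m) =
    trans (length-filterᵇ-++ p (F (suc (g 0))) _)
          (cong (length (filterᵇ p (F (suc (g 0)))) +_) (length-filterᵇ-concatMap p F (g ∘ suc) m))

-- Pell numbers and powers of 1 ± √2

mutual
  pell : ℕ → ℕ
  pell zero    = 0
  pell (suc m) = halfCompanionPell m + pell m

  halfCompanionPell : ℕ → ℕ
  halfCompanionPell zero    = 1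
  halfCompanionPell (suc m) = halfCompanionPell m + 2 * pell m

pell-suc-suc : ∀ m → pell (suc (suc m)) ≡ 2 * pell (suc m) + pell m
pell-suc-suc m = lemma (halfCompanionPell m) (pell m)
  where
    lemma : ∀ h p → (h + 2 * p) + (h + p) ≡ 2 * (h + p) + p
    lemma = ℕ-Solver.solve-∀

halfCompanionPell-suc : ∀ m → halfCompanionPell (suc m) ≡ pell (suc m) + pell m
halfCompanionPell-suc m = lemma (halfCompanionPell m) (pell m)
  where
    lemma : ∀ h p → h + 2 * p ≡ (h + p) + p
    lemma = ℕ-Solver.solve-∀

onePlusSqrt2-⊗ : ∀ x y → onePlusSqrt2 ⊗ mk√ x y ≡ mk√ (x +ℤ ℤ.+ 2 *ℤ y) (x +ℤ y)
onePlusSqrt2-⊗ x y = cong₂ mk√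
  (cong₂ _+ℤ_ (ℤ.*-identityˡ x) (cong (ℤ.+ 2 *ℤ_) (ℤ.*-identityˡ y)))
  (trans (cong₂ _+ℤ_ (ℤ.*-identityˡ y) (ℤ.*-identityˡ x)) (ℤ.+-comm y x))

oneMinusSqrt2-⊗ : ∀ x y → oneMinusSqrt2 ⊗ mk√ x y ≡ mk√ (x +ℤ ℤ.+ 2 *ℤ (- y)) (y +ℤ - x)
oneMinusSqrt2-⊗ x y = cong₂ mk√
  (cong₂ _+ℤ_ (ℤ.*-identityˡ x) (cong (ℤ.+ 2 *ℤ_) (ℤ.-1*i≡-i y)))
  (cong₂ _+ℤ_ (ℤ.*-identityˡ y) (ℤ.-1*i≡-i x))

pos-+-2* : ∀ h p → ℤ.+ (h + 2 * p) ≡ ℤ.+ h +ℤ ℤ.+ 2 *ℤ ℤ.+ p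
pos-+-2* h p = trans (ℤ.pos-+ h (2 * p)) (cong (ℤ.+ h +ℤ_) (ℤ.pos-* 2 p))

onePlusSqrt2-^ : ∀ m → onePlusSqrt2 ^√ m ≡ mk√ (ℤ.+ halfCompanionPell m) (ℤ.+ pell m)
onePlusSqrt2-^ zero    = refl
onePlusSqrt2-^ (suc m) = begin
  onePlusSqrt2 ⊗ (onePlusSqrt2 ^√ m)
    ≡⟨ cong (onePlusSqrt2 ⊗_) (onePlusSqrt2-^ m) ⟩
  onePlusSqrt2 ⊗ mk√ (ℤ.+ h) (ℤ.+ p)
    ≡⟨ onePlusSqrt2-⊗ (ℤ.+ h) (ℤ.+ p) ⟩
  mk√ (ℤ.+ h +ℤ ℤ.+ 2 *ℤ ℤ.+ p) (ℤ.+ h +ℤ ℤ.+ p)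
    ≡⟨ cong₂ mk√ (sym (pos-+-2* h p)) (sym (ℤ.pos-+ h p)) ⟩
  mk√ (ℤ.+ (h + 2 * p)) (ℤ.+ (h + p))
    ∎
  where
    open ≡-Reasoning
    h = halfCompanionPell m
    p = pell m

oneMinusSqrt2-^ : ∀ m → oneMinusSqrt2 ^√ m ≡ mk√ (ℤ.+ halfCompanionPell m) (- ℤ.+ pell m)
oneMinusSqrt2-^ zero    = refl
oneMinusSqrt2-^ (suc m) = begin
  oneMinusSqrt2 ⊗ (oneMinusSqrt2 ^√ m)
    ≡⟨ cong (oneMinusSqrt2 ⊗_) (oneMinusSqrt2-^ m) ⟩
  oneMinusSqrt2 ⊗ mk√ (ℤ.+ h) (- ℤ.+ p)
    ≡⟨ oneMinusSqrt2-⊗ (ℤ.+ h) (- ℤ.+ p) ⟩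
  mk√ (ℤ.+ h +ℤ ℤ.+ 2 *ℤ (- - ℤ.+ p)) (- ℤ.+ p +ℤ - ℤ.+ h)
    ≡⟨ cong₂ mk√ re-eq im-eq ⟩
  mk√ (ℤ.+ (h + 2 * p)) (- ℤ.+ (h + p))
    ∎
  where
    open ≡-Reasoning
    h = halfCompanionPell m
    p = pell m
    re-eq : ℤ.+ h +ℤ ℤ.+ 2 *ℤ (- - ℤ.+ p) ≡ ℤ.+ (h + 2 * p)
    re-eq = trans (cong (λ z → ℤ.+ h +ℤ ℤ.+ 2 *ℤ z) (ℤ.neg-involutive (ℤ.+ p)))
      (sym (pos-+-2* h p))
    im-eq : - ℤ.+ p +ℤ - ℤ.+ h ≡ - ℤ.+ (h + p)
    im-eq = trans (ℤ.+-comm (- ℤ.+ p) (- ℤ.+ h))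
      (trans (sym (ℤ.neg-distrib-+ (ℤ.+ h) (ℤ.+ p))) (cong -_ (sym (ℤ.pos-+ h p))))

conjugatePowers-sum : ∀ m → (onePlusSqrt2 ^√ m) ⊕ (oneMinusSqrt2 ^√ m) ≡ fromℕ√ (2 * halfCompanionPell m)
conjugatePowers-sum m rewrite onePlusSqrt2-^ m | oneMinusSqrt2-^ m = cong₂ mk√
  (trans (sym (ℤ.pos-+ h h)) (cong ℤ.+_ (cong (h +_) (sym (+-identityʳ h)))))
  (ℤ.+-inverseʳ (ℤ.+ pell m))
  where h = halfCompanionPell m

-- Parking on a street with spots 1, …, n

module Street (n : ℕ) where

  -- A parking state is the predicate of vacant spots; spots outside 1, …, n are never vacant.
  Vacancy : Set
  Vacancy = ℕ → Bool

  occupy : ℕ → Vacancy → Vacancy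
  occupy s φ t = not (s ≡ᵇ t) ∧ φ t

  spotFor : Vacancy → ℕ → Maybe ℕ
  spotFor φ a =
    if φ a then just a
    else if φ (a ∸ 1) then just (a ∸ 1)
    else if φ (suc a) then just (suc a)
    else nothing

  parks : Vacancy → List ℕ → Bool
  parks φ []       = true
  parks φ (a ∷ as) = maybe′ (λ s → parks (occupy s φ) as) false (spotFor φ a)

  spotFor-cong : ∀ {φ ψ} → φ ≗ ψ → ∀ a → spotFor φ a ≡ spotFor ψ a
  spotFor-cong φ≗ψ a rewrite φ≗ψ a | φ≗ψ (a ∸ 1) | φ≗ψ (suc a) = refl

  parks-cong : ∀ {φ ψ} → φ ≗ ψ → parks φ ≗ parks ψ
  parks-cong φ≗ψ []       = refl
  parks-cong {ψ = ψ} φ≗ψ (a ∷ as) rewrite spotFor-cong φ≗ψ a with spotFor ψ a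
  ... | nothing = refl
  ... | just s  = parks-cong (λ t → cong (not (s ≡ᵇ t) ∧_) (φ≗ψ t)) as

  spotFor-here : ∀ φ a → φ a ≡ true → spotFor φ a ≡ just a
  spotFor-here φ a φa rewrite φa = refl

  spotFor-left : ∀ φ a → φ a ≡ false → φ (a ∸ 1) ≡ true → spotFor φ a ≡ just (a ∸ 1)
  spotFor-left φ a φa φa-1 rewrite φa | φa-1 = refl

  spotFor-right : ∀ φ a → φ a ≡ false → φ (a ∸ 1) ≡ false → φ (suc a) ≡ true → spotFor φ a ≡ just (suc a)
  spotFor-right φ a φa φa-1 φa+1 rewrite φa | φa-1 | φa+1 = refl

  spotFor-none : ∀ φ a → φ a ≡ false → φ (a ∸ 1) ≡ false → φ (suc a) ≡ false → spotFor φ a ≡ nothing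
  spotFor-none φ a φa φa-1 φa+1 rewrite φa | φa-1 | φa+1 = refl

  spotFor-sound : ∀ {φ a s} → spotFor φ a ≡ just s → φ s ≡ true × a ∸ 1 ≤ s
  spotFor-sound {φ} {a} spot with φ a in φa
  spotFor-sound {a = a} refl | true = φa , m∸n≤m a 1
  ... | false with φ (a ∸ 1) in φa-1
  spotFor-sound refl | false | true = φa-1 , ≤-refl
  ... | false with φ (suc a) in φa+1
  spotFor-sound {a = a} refl | false | false | true  = φa+1 , ≤-trans (m∸n≤m a 1) (n≤1+n a)
  spotFor-sound ()   | false | false | false

  parkCar≡spotFor : ∀ occ a → parkCar n occ a ≡ Maybe.map (_∷ occ) (spotFor (free n occ) a)
  parkCar≡spotFor occ a with free n occ a
  ... | true = refl
  ... | false with free n occ (a ∸ 1)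
  ...   | true = refl
  ...   | false with free n occ (suc a)
  ...     | true  = refl
  ...     | false = refl

  free-∷ : ∀ s occ → free n (s ∷ occ) ≗ occupy s (free n occ)
  free-∷ s occ t with s ≡ᵇ t
  ... | true  = ∧-zeroʳ (validSpot n t)
  ... | false = refl

  parkAll≡parks : ∀ occ → parkAll n occ ≗ parks (free n occ)
  parkAll≡parks occ []       = refl
  parkAll≡parks occ (a ∷ as) rewrite parkCar≡spotFor occ a with spotFor (free n occ) a
  ... | nothing = refl
  ... | just s  = trans (parkAll≡parks (s ∷ occ) as) (parks-cong (free-∷ s occ) as)

  vacantFrom : ℕ → Vacancy
  vacantFrom k t = validSpot n t ∧ (k ≤ᵇ t)

  holeAt : ℕ → Vacancy
  holeAt k = occupy (suc k) (vacantFrom k)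

  free-[] : free n [] ≗ vacantFrom 1
  free-[] zero    = refl
  free-[] (suc t) = refl

  vacantFrom-vacant : ∀ {k t} → 1 ≤ t → t ≤ n → k ≤ t → vacantFrom k t ≡ true
  vacantFrom-vacant 1≤t t≤n k≤t rewrite ≤⇒≤ᵇ≡true 1≤t | ≤⇒≤ᵇ≡true t≤n | ≤⇒≤ᵇ≡true k≤t = refl

  vacantFrom-taken : ∀ {k t} → t < k → vacantFrom k t ≡ false
  vacantFrom-taken t<k rewrite >⇒≤ᵇ≡false t<k = ∧-zeroʳ _

  OnStreet : Vacancy → Set
  OnStreet φ = ∀ {s} → φ s ≡ true → s ≤ n

  occupy-onStreet : ∀ {φ} s → OnStreet φ → OnStreet (occupy s φ)
  occupy-onStreet s onStreet occ = onStreet (∧-true-r occ)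
    where
      ∧-true-r : ∀ {x y} → x ∧ y ≡ true → y ≡ true
      ∧-true-r {true} y≡true = y≡true

  vacantFrom-onStreet : ∀ k → OnStreet (vacantFrom k)
  vacantFrom-onStreet k {t} vacant with 1 ≤ᵇ t | t ≤ᵇ n in t≤ᵇn | k ≤ᵇ t
  ... | true | true | true = ≤ᵇ≡true⇒≤ t≤ᵇn

  occupy-comm : ∀ s s′ φ → occupy s (occupy s′ φ) ≗ occupy s′ (occupy s φ)
  occupy-comm s s′ φ t = ∧-leftComm (not (s ≡ᵇ t)) (not (s′ ≡ᵇ t)) (φ t)

  occupy-vacantFrom : ∀ k → occupy k (vacantFrom k) ≗ vacantFrom (suc k)
  occupy-vacantFrom k t =
    trans (∧-leftComm (not (k ≡ᵇ t)) (validSpot n t) (k ≤ᵇ t))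
          (cong (validSpot n t ∧_) (sym (suc-≤ᵇ k t)))

  occupy-holeAt : ∀ k → occupy k (holeAt k) ≗ vacantFrom (suc (suc k))
  occupy-holeAt k t = begin
    occupy k (occupy (suc k) (vacantFrom k)) t ≡⟨ occupy-comm k (suc k) (vacantFrom k) t ⟩
    occupy (suc k) (occupy k (vacantFrom k)) t ≡⟨ cong (not (suc k ≡ᵇ t) ∧_) (occupy-vacantFrom k t) ⟩
    occupy (suc k) (vacantFrom (suc k)) t      ≡⟨ occupy-vacantFrom (suc k) t ⟩
    vacantFrom (suc (suc k)) t                 ∎
    where open ≡-Reasoning

  -- p plays the role of the previous car's preference. The counts are opaque so that unification
  -- treats them as rigid; they are used only through the lemmas of the next block.
  opaque
    parkingCount : Vacancy → ℕ → ℕ → ℕ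
    parkingCount φ p r = length (filterᵇ (λ α → parks φ α ∧ nondecreasing (p ∷ α)) (lists r n))

    firstCar : Vacancy → ℕ → ℕ → ℕ → ℕ
    firstCar φ p r a = if p ≤ᵇ a then maybe′ (λ s → parkingCount (occupy s φ) a r) 0 (spotFor φ a) else 0

  opaque
    unfolding parkingCount firstCar

    length-VPF↑ : length (VPF↑ n) ≡ parkingCount (vacantFrom 1) 0 n
    length-VPF↑ = length-filterᵇ-cong isVPF↑ (lists n n)
      where
        nondecreasing-0∷ : ∀ α → nondecreasing α ≡ nondecreasing (0 ∷ α)
        nondecreasing-0∷ []      = refl
        nondecreasing-0∷ (_ ∷ _) = refl
        isVPF↑ : ∀ α → isVPF n α ∧ nondecreasing α ≡ parks (vacantFrom 1) α ∧ nondecreasing (0 ∷ α)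
        isVPF↑ α = cong₂ _∧_ (trans (parkAll≡parks [] α) (parks-cong free-[] α)) (nondecreasing-0∷ α)

    parkingCount-zero : ∀ φ p → parkingCount φ p 0 ≡ 1
    parkingCount-zero φ p = refl

    parkingCount-cong : ∀ {φ ψ} → φ ≗ ψ → ∀ p r → parkingCount φ p r ≡ parkingCount ψ p r
    parkingCount-cong φ≗ψ p r =
      length-filterᵇ-cong (λ α → cong (_∧ nondecreasing (p ∷ α)) (parks-cong φ≗ψ α)) (lists r n)

    parkingCount-suc : ∀ φ p r → parkingCount φ p (suc r) ≡ ∑[ i < n ] firstCar φ p r (suc i)
    parkingCount-suc φ p r =
      trans (length-filterᵇ-concatMap _ (λ a → map (a ∷_) (lists r n)) id n)
            (∑<-cong (λ i → trans (length-filterᵇ-map _ (suc i ∷_) (lists r n)) (startingWith (suc i))) n)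
      where
        startingWith : ∀ a →
          length (filterᵇ (λ α → parks φ (a ∷ α) ∧ nondecreasing (p ∷ a ∷ α)) (lists r n)) ≡ firstCar φ p r a
        startingWith a with p ≤ᵇ a
        ... | false = length-filterᵇ-none (λ α → ∧-zeroʳ _) (lists r n)
        ... | true with spotFor φ a
        ...   | nothing = length-filterᵇ-none (λ α → refl) (lists r n)
        ...   | just s  = refl

    firstCar-parks : ∀ {φ p r a s} → p ≤ a → spotFor φ a ≡ just s →
      firstCar φ p r a ≡ parkingCount (occupy s φ) a r
    firstCar-parks p≤a spot rewrite ≤⇒≤ᵇ≡true p≤a | spot = refl

    firstCar-stuck : ∀ {φ p r a} → spotFor φ a ≡ nothing → firstCar φ p r a ≡ 0
    firstCar-stuck {p = p} {a = a} spot rewrite spot with p ≤ᵇ a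
    ... | true  = refl
    ... | false = refl

    firstCar-below : ∀ {φ p r a} → a < p → firstCar φ p r a ≡ 0
    firstCar-below a<p rewrite >⇒≤ᵇ≡false a<p = refl

  #vacant : Vacancy → ℕ → ℕ → ℕ
  #vacant φ lo zero    = 0
  #vacant φ lo (suc h) = (if (lo ≤ᵇ h) ∧ φ h then 1 else 0) + #vacant φ lo h

  #vacant-≤ : ∀ φ lo h → #vacant φ lo h ≤ h ∸ lo
  #vacant-≤ φ lo zero    = z≤n
  #vacant-≤ φ lo (suc h) with lo ≤? h
  ... | no lo≰h rewrite >⇒≤ᵇ≡false (≰⇒> lo≰h) = ≤-trans (#vacant-≤ φ lo h) (∸-monoˡ-≤ lo (n≤1+n h))
  ... | yes lo≤h rewrite ≤⇒≤ᵇ≡true lo≤h | +-∸-assoc 1 lo≤h with φ h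
  ...   | true  = s≤s (#vacant-≤ φ lo h)
  ...   | false = m≤n⇒m≤1+n (#vacant-≤ φ lo h)

  #vacant-antitone : ∀ φ {lo lo′} → lo ≤ lo′ → ∀ h → #vacant φ lo′ h ≤ #vacant φ lo h
  #vacant-antitone φ lo≤lo′ zero = z≤n
  #vacant-antitone φ {lo} {lo′} lo≤lo′ (suc h) with lo′ ≤? h
  ... | yes lo′≤h rewrite ≤⇒≤ᵇ≡true lo′≤h | ≤⇒≤ᵇ≡true (≤-trans lo≤lo′ lo′≤h) =
    +-monoʳ-≤ (if φ h then 1 else 0) (#vacant-antitone φ lo≤lo′ h)
  ... | no lo′≰h rewrite >⇒≤ᵇ≡false (≰⇒> lo′≰h) = ≤-trans (#vacant-antitone φ lo≤lo′ h) (m≤n+m _ _)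

  #vacant-occupy-above : ∀ s φ lo h → h ≤ s → #vacant (occupy s φ) lo h ≡ #vacant φ lo h
  #vacant-occupy-above s φ lo zero    h≤s = refl
  #vacant-occupy-above s φ lo (suc h) h<s rewrite ≢⇒≡ᵇ≡false (>⇒≢ h<s) =
    cong ((if (lo ≤ᵇ h) ∧ φ h then 1 else 0) +_) (#vacant-occupy-above s φ lo h (<⇒≤ h<s))

  #vacant-occupy : ∀ {s φ lo h} → φ s ≡ true → lo ≤ s → s < h →
    suc (#vacant (occupy s φ) lo h) ≡ #vacant φ lo h
  #vacant-occupy {s} {φ} {lo} {suc h} φs lo≤s s<h with s ≟ h
  ... | yes refl rewrite ≡ᵇ-refl s | ≤⇒≤ᵇ≡true lo≤s | φs =
    cong suc (#vacant-occupy-above s φ lo s ≤-refl)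
  ... | no s≢h rewrite ≢⇒≡ᵇ≡false s≢h =
    trans (sym (+-suc (if (lo ≤ᵇ h) ∧ φ h then 1 else 0) _))
          (cong ((if (lo ≤ᵇ h) ∧ φ h then 1 else 0) +_) (#vacant-occupy φs lo≤s (≤∧≢⇒< (≤-pred s<h) s≢h)))

  -- A car with preference at least p parks at a spot at least p ∸ 1, so cars outnumbering the
  -- vacant spots from p ∸ 1 on cannot all park.
  mutual
    parkingCount-overfull : ∀ {φ} p r → OnStreet φ → #vacant φ (p ∸ 1) (suc n) < r →
      parkingCount φ p r ≡ 0
    parkingCount-overfull {φ} p (suc r) onStreet overfull = trans (parkingCount-suc φ p r)
      (∑<-zero n (λ i _ → firstCar-overfull (suc i) onStreet λ p≤a →
        ≤-pred (≤-trans (s≤s (#vacant-antitone φ (∸-monoˡ-≤ 1 p≤a) (suc n))) overfull)))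

    firstCar-overfull : ∀ {φ p r} a → OnStreet φ → (p ≤ a → #vacant φ (a ∸ 1) (suc n) ≤ r) →
      firstCar φ p r a ≡ 0
    firstCar-overfull {φ} {p} {r} a onStreet overfull with p ≤? a
    ... | no p≰a = firstCar-below (≰⇒> p≰a)
    ... | yes p≤a with spotFor φ a in spot
    ...   | nothing = firstCar-stuck spot
    ...   | just s with spotFor-sound {φ} {a} spot
    ...     | φs , a-1≤s =
      trans (firstCar-parks p≤a spot) (parkingCount-overfull a r (occupy-onStreet s onStreet) fewer-vacant)
      where
        fewer-vacant : #vacant (occupy s φ) (a ∸ 1) (suc n) < r
        fewer-vacant =
          subst (_≤ r) (sym (#vacant-occupy {s} {φ} φs a-1≤s (s≤s (onStreet φs)))) (overfull p≤a)

  firstCar-vacantFrom-blocked : ∀ {k p r a} → suc a < k → firstCar (vacantFrom k) p r a ≡ 0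
  firstCar-vacantFrom-blocked {k} {p} {r} {a} a+1<k = firstCar-stuck (spotFor-none (vacantFrom k) a
    (vacantFrom-taken (<-trans (n<1+n a) a+1<k))
    (vacantFrom-taken (≤-<-trans (m∸n≤m a 1) (<-trans (n<1+n a) a+1<k)))
    (vacantFrom-taken a+1<k))

  firstCar-vacantFrom-pred : ∀ {p r a} → suc a ≤ n → p ≤ a →
    firstCar (vacantFrom (suc a)) p r a ≡ parkingCount (vacantFrom (suc (suc a))) a r
  firstCar-vacantFrom-pred {r = r} {a} a<n p≤a = trans
    (firstCar-parks p≤a (spotFor-right (vacantFrom (suc a)) a
      (vacantFrom-taken (n<1+n a)) (vacantFrom-taken (s≤s (m∸n≤m a 1))) (vacantFrom-vacant (s≤s z≤n) a<n ≤-refl)))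
    (parkingCount-cong (occupy-vacantFrom (suc a)) a r)

  firstCar-vacantFrom-at : ∀ {k p r} → 1 ≤ k → k ≤ n → p ≤ k →
    firstCar (vacantFrom k) p r k ≡ parkingCount (vacantFrom (suc k)) k r
  firstCar-vacantFrom-at {k} {r = r} 1≤k k≤n p≤k = trans
    (firstCar-parks p≤k (spotFor-here (vacantFrom k) k (vacantFrom-vacant 1≤k k≤n ≤-refl)))
    (parkingCount-cong (occupy-vacantFrom k) k r)

  firstCar-vacantFrom-next : ∀ {k p r} → suc k ≤ n → p ≤ suc k →
    firstCar (vacantFrom k) p r (suc k) ≡ parkingCount (holeAt k) (suc k) r
  firstCar-vacantFrom-next {k} k<n p≤k+1 =
    firstCar-parks p≤k+1 (spotFor-here (vacantFrom k) (suc k) (vacantFrom-vacant (s≤s z≤n) k<n (n≤1+n k)))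

  firstCar-holeAt-back : ∀ {k r} → 1 ≤ k → k ≤ n →
    firstCar (holeAt k) (suc k) r (suc k) ≡ parkingCount (vacantFrom (suc (suc k))) (suc k) r
  firstCar-holeAt-back {k} {r} 1≤k k≤n = trans
    (firstCar-parks ≤-refl (spotFor-left (holeAt k) (suc k) hole vacant))
    (parkingCount-cong (occupy-holeAt k) (suc k) r)
    where
      hole : holeAt k (suc k) ≡ false
      hole rewrite ≡ᵇ-refl k = refl
      vacant : holeAt k k ≡ true
      vacant rewrite ≢⇒≡ᵇ≡false {suc k} {k} (1+n≢n) = vacantFrom-vacant 1≤k k≤n ≤-refl

  vacantFrom-#vacant : ∀ {k r} → k + r ≡ n → #vacant (vacantFrom k) (suc k) (suc n) ≤ r
  vacantFrom-#vacant {k} {r} refl =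
    ≤-trans (#vacant-≤ (vacantFrom k) (suc k) (suc (k + r))) (≤-reflexive (m+n∸m≡n k r))

  firstCar-vacantFrom-far : ∀ {k p r a} → k + r ≡ n → suc (suc k) ≤ a → firstCar (vacantFrom k) p r a ≡ 0
  firstCar-vacantFrom-far {k} {a = a} k+r≡n k+2≤a = firstCar-overfull a (vacantFrom-onStreet k) λ _ →
    ≤-trans (#vacant-antitone (vacantFrom k) (∸-monoˡ-≤ 1 k+2≤a) (suc n)) (vacantFrom-#vacant k+r≡n)

  firstCar-holeAt-far : ∀ {k r a} → k + suc r ≡ n → suc (suc k) ≤ a → firstCar (holeAt k) (suc k) r a ≡ 0
  firstCar-holeAt-far {k} {r} {a} k+r+1≡n k+2≤a =
    firstCar-overfull a (occupy-onStreet (suc k) (vacantFrom-onStreet k)) λ _ → ≤-pred (begin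
      suc (#vacant (holeAt k) (a ∸ 1) (suc n))
        ≤⟨ s≤s (#vacant-antitone (holeAt k) (∸-monoˡ-≤ 1 k+2≤a) (suc n)) ⟩
      suc (#vacant (holeAt k) (suc k) (suc n))
        ≡⟨ #vacant-occupy (vacantFrom-vacant (s≤s z≤n) k<n (n≤1+n k)) ≤-refl (s≤s k<n) ⟩
      #vacant (vacantFrom k) (suc k) (suc n)
        ≤⟨ vacantFrom-#vacant k+r+1≡n ⟩
      suc r
        ∎)
    where
      open ≤-Reasoning
      k<n : suc k ≤ n
      k<n = subst (suc k ≤_) k+r+1≡n (m<m+n k (s≤s z≤n))

  mutual
    parkingCount-vacantFrom : ∀ {j p} r → j + suc r ≡ n → p ≤ suc j →
      parkingCount (vacantFrom (suc (suc j))) p r ≡ pell (suc r)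
    parkingCount-vacantFrom zero _ _ = parkingCount-zero _ _
    parkingCount-vacantFrom {j} {p} (suc zero) j+2≡n p≤j+1 = begin
      parkingCount (vacantFrom k) p 1
        ≡⟨ parkingCount-suc (vacantFrom k) p 0 ⟩
      ∑[ i < n ] firstCar (vacantFrom k) p 0 (suc i)
        ≡⟨ ∑<-window j 2 0 _ j+2≡n (λ _ i<j → firstCar-vacantFrom-blocked (s≤s (s≤s i<j))) (λ _ ()) ⟩
      firstCar (vacantFrom k) p 0 (suc j) + (firstCar (vacantFrom k) p 0 k + 0)
        ≡⟨ cong₂ _+_ (firstCar-vacantFrom-pred k≤n p≤j+1)
                     (cong (_+ 0) (firstCar-vacantFrom-at (s≤s z≤n) k≤n (m≤n⇒m≤1+n p≤j+1))) ⟩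
      parkingCount (vacantFrom (suc k)) (suc j) 0 + (parkingCount (vacantFrom (suc k)) k 0 + 0)
        ≡⟨ cong₂ _+_ (parkingCount-zero _ _) (cong (_+ 0) (parkingCount-zero _ _)) ⟩
      pell 2
        ∎
      where
        open ≡-Reasoning
        k = suc (suc j)
        k≤n : k ≤ n
        k≤n = subst (k ≤_) j+2≡n (≤-reflexive (+-comm 2 j))
    parkingCount-vacantFrom {j} {p} (suc (suc r)) j+r+3≡n p≤j+1 = begin
      parkingCount (vacantFrom k) p (suc (suc r))
        ≡⟨ parkingCount-suc (vacantFrom k) p (suc r) ⟩
      ∑[ i < n ] firstCar (vacantFrom k) p (suc r) (suc i)
        ≡⟨ ∑<-window j 3 r _ j+r+3≡n (λ _ i<j → firstCar-vacantFrom-blocked (s≤s (s≤s i<j))) far ⟩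
      F (suc j) + (F k + (F (suc k) + 0))
        ≡⟨ cong₂ _+_ (firstCar-vacantFrom-pred k≤n p≤j+1)
             (cong₂ _+_ (firstCar-vacantFrom-at (s≤s z≤n) k≤n p≤k)
                        (cong (_+ 0) (firstCar-vacantFrom-next k<n p≤k+1))) ⟩
      parkingCount (vacantFrom (suc k)) (suc j) (suc r)
        + (parkingCount (vacantFrom (suc k)) k (suc r) + (parkingCount (holeAt k) (suc k) (suc r) + 0))
        ≡⟨ cong₂ _+_ (parkingCount-vacantFrom (suc r) j+1+r+2≡n (n≤1+n (suc j)))
             (cong₂ _+_ (parkingCount-vacantFrom (suc r) j+1+r+2≡n ≤-refl)
                        (cong (_+ 0) (parkingCount-holeAt r k+r+1≡n))) ⟩
      pell (suc (suc r)) + (pell (suc (suc r)) + (pell (suc r) + 0))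
        ≡⟨ twice-plus (pell (suc (suc r))) (pell (suc r)) ⟩
      2 * pell (suc (suc r)) + pell (suc r)
        ≡⟨ pell-suc-suc (suc r) ⟨
      pell (suc (suc (suc r)))
        ∎
      where
        open ≡-Reasoning
        k = suc (suc j)
        F : ℕ → ℕ
        F = firstCar (vacantFrom k) p (suc r)
        j+1+r+2≡n : suc j + suc (suc r) ≡ n
        j+1+r+2≡n = trans (sym (+-suc j (suc (suc r)))) j+r+3≡n
        k+r+1≡n : k + suc r ≡ n
        k+r+1≡n = trans (sym (+-suc (suc j) (suc r))) j+1+r+2≡n
        3+j≤j+3+_ : ∀ i → 3 + j ≤ j + (3 + i)
        3+j≤j+3+ i = subst (_≤ j + (3 + i)) (+-comm j 3) (+-monoʳ-≤ j (m≤m+n 3 i))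
        k<n : suc k ≤ n
        k<n = subst (suc k ≤_) j+r+3≡n (3+j≤j+3+ r)
        k≤n : k ≤ n
        k≤n = <⇒≤ k<n
        p≤k : p ≤ k
        p≤k = m≤n⇒m≤1+n p≤j+1
        p≤k+1 : p ≤ suc k
        p≤k+1 = m≤n⇒m≤1+n p≤k
        far : ∀ i → i < r → F (suc (j + (3 + i))) ≡ 0
        far i _ = firstCar-vacantFrom-far k+r+1≡n (s≤s (3+j≤j+3+ i))
        twice-plus : ∀ x y → x + (x + (y + 0)) ≡ 2 * x + y
        twice-plus = ℕ-Solver.solve-∀

    parkingCount-holeAt : ∀ {j} r → suc j + suc r ≡ n →
      parkingCount (holeAt (suc j)) (suc (suc j)) (suc r) ≡ pell (suc r)
    parkingCount-holeAt {j} r j+r+2≡n = begin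
      parkingCount (holeAt k) (suc k) (suc r)
        ≡⟨ parkingCount-suc (holeAt k) (suc k) r ⟩
      ∑[ i < n ] firstCar (holeAt k) (suc k) r (suc i)
        ≡⟨ ∑<-window k 1 r _ j+r+2≡n (λ _ i<k → firstCar-below (s≤s i<k)) far ⟩
      firstCar (holeAt k) (suc k) r (suc k) + 0
        ≡⟨ +-identityʳ _ ⟩
      firstCar (holeAt k) (suc k) r (suc k)
        ≡⟨ firstCar-holeAt-back (s≤s z≤n) k≤n ⟩
      parkingCount (vacantFrom (suc (suc k))) (suc k) r
        ≡⟨ parkingCount-vacantFrom r j+r+2≡n ≤-refl ⟩
      pell (suc r)
        ∎
      where
        open ≡-Reasoning
        k = suc j
        k≤n : k ≤ n
        k≤n = subst (k ≤_) j+r+2≡n (m≤m+n k (suc r))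
        far : ∀ i → i < r → firstCar (holeAt k) (suc k) r (suc (k + (1 + i))) ≡ 0
        far i _ = firstCar-holeAt-far j+r+2≡n (s≤s (s≤s (m<m+n j (s≤s z≤n))))

  parkingCount-empty : ∀ {m} → suc m ≡ n → parkingCount (vacantFrom 1) 0 (suc m) ≡ pell (suc m) + pell m
  parkingCount-empty {zero} 1≡n = begin
    parkingCount (vacantFrom 1) 0 1
      ≡⟨ parkingCount-suc (vacantFrom 1) 0 0 ⟩
    ∑[ i < n ] firstCar (vacantFrom 1) 0 0 (suc i)
      ≡⟨ ∑<-window 0 1 0 _ 1≡n (λ _ ()) (λ _ ()) ⟩
    firstCar (vacantFrom 1) 0 0 1 + 0
      ≡⟨ cong (_+ 0) (firstCar-vacantFrom-at ≤-refl (≤-reflexive 1≡n) z≤n) ⟩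
    parkingCount (vacantFrom 2) 1 0 + 0
      ≡⟨ cong (_+ 0) (parkingCount-zero _ _) ⟩
    pell 1 + pell 0
      ∎
    where open ≡-Reasoning
  parkingCount-empty {suc r} r+2≡n = begin
    parkingCount (vacantFrom 1) 0 (suc (suc r))
      ≡⟨ parkingCount-suc (vacantFrom 1) 0 (suc r) ⟩
    ∑[ i < n ] firstCar (vacantFrom 1) 0 (suc r) (suc i)
      ≡⟨ ∑<-window 0 2 r _ r+2≡n (λ _ ()) far ⟩
    firstCar (vacantFrom 1) 0 (suc r) 1 + (firstCar (vacantFrom 1) 0 (suc r) 2 + 0)
      ≡⟨ cong₂ _+_ (firstCar-vacantFrom-at ≤-refl (≤-trans (s≤s z≤n) 2≤n) z≤n)
                   (cong (_+ 0) (firstCar-vacantFrom-next 2≤n z≤n)) ⟩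
    parkingCount (vacantFrom 2) 1 (suc r) + (parkingCount (holeAt 1) 2 (suc r) + 0)
      ≡⟨ cong₂ _+_ (parkingCount-vacantFrom (suc r) r+2≡n ≤-refl)
                   (trans (+-identityʳ _) (parkingCount-holeAt r r+2≡n)) ⟩
    pell (suc (suc r)) + pell (suc r)
      ∎
    where
      open ≡-Reasoning
      2≤n : 2 ≤ n
      2≤n = subst (2 ≤_) r+2≡n (s≤s (s≤s z≤n))
      far : ∀ i → i < r → firstCar (vacantFrom 1) 0 (suc r) (suc (2 + i)) ≡ 0
      far i _ = firstCar-vacantFrom-far r+2≡n (s≤s (s≤s (s≤s z≤n)))

corollary3p4 : (n : ℕ) → n ≥ 1 →
    fromℕ√ (2 * length (VPF↑ n)) ≡ (onePlusSqrt2 ^√ n) ⊕ (oneMinusSqrt2 ^√ n)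
corollary3p4 zero    ()
corollary3p4 (suc m) _ = begin
  fromℕ√ (2 * length (VPF↑ (suc m)))          ≡⟨ cong (λ c → fromℕ√ (2 * c)) count ⟩
  fromℕ√ (2 * halfCompanionPell (suc m))      ≡⟨ conjugatePowers-sum (suc m) ⟨
  (onePlusSqrt2 ^√ suc m) ⊕ (oneMinusSqrt2 ^√ suc m) ∎
  where
    open ≡-Reasoning
    open Street (suc m)
    count : length (VPF↑ (suc m)) ≡ halfCompanionPell (suc m)
    count = begin
      length (VPF↑ (suc m))                  ≡⟨ length-VPF↑ ⟩
      parkingCount (vacantFrom 1) 0 (suc m)  ≡⟨ parkingCount-empty refl ⟩
      pell (suc m) + pell m                  ≡⟨ halfCompanionPell-suc m ⟨
      halfCompanionPell (suc m)              ∎
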